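{- Let $H$ be a finite digraph and let $a,b,c$ be three distinct vertices of $H$ such that the weak component of $H^*$ containing $(a,b)$ contains neither $(a,c)$ nor $(c,b)$. Let $A,B,C$ be constricted walks in $H$ of the same net length, starting at $a,b,c$ respectively, and suppose that $A$ and $B$ are congruent and avoid each other. Then there exist congruent common pre-images $A',B',C'$ of $A,B,C$, starting at $a,b,c$ respectively, such that $B'$ and $C'$ avoid each other, and $A'$ and $C'$ avoid each other.
   Context: A walk $W=w_0,\dots,w_n$ in $H$ is a sequence of vertices where each $w_iw_{i+1}$ is either a forward arc ($w_iw_{i+1}\in A(H)$) or a backward arc ($w_{i+1}w_i\in A(H)$), with a designated choice; its net length is (#forward) $-$ (#backward). The walk is constricted if no initial subwalk $w_0,\dots,w_i$ has negative net length and no initial subwalk has net length greater than that of $W$. Walks $P=x_0,\dots,x_n$, $Q=y_0,\dots,y_n$ are congruent if $x_ix_{i+1}$ is forward iff $y_iy_{i+1}$ is forward. For congruent $P,Q$, $x_iy_{i+1}$ is a faithful arc from $P$ to $Q$ if it is a forward (resp. backward) arc when $x_ix_{i+1}$ is forward (resp. backward); $y_ix_{i+1}$ is a faithful arc from $Q$ to $P$ analogously. $P,Q$ avoid each other if for no $i\in\{0,\dots,n-1\}$ are both $x_iy_{i+1}$ and $y_ix_{i+1}$ faithful arcs. The digraph $H^*$ has vertex set all ordered pairs $(x,y)$ of distinct vertices of $H$, with an arc from $(x,y)$ to $(x',y')$ iff $xx',yy'\in A(H)$ but not both $xy',yx'\in A(H)$. For a walk $W=w_0,\dots,w_n$ let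 $\hat W$ be the oriented path on $\{0,\dots,n\}$ with arc $i\to i+1$ if $w_iw_{i+1}$ is forward and $i+1\to i$ otherwise. Congruent common pre-images of walks $A,B,C$ are walks $A'=w^A_{\varphi_A(s_0)},\dots,w^A_{\varphi_A(s_t)}$ (and similarly $B',C'$), where $S=s_0,\dots,s_t$ is an oriented path and $\varphi_A,\varphi_B,\varphi_C$ are homomorphisms of $S$ to $\hat A,\hat B,\hat C$ mapping $s_0$ to the first and $s_t$ to the last vertex of the respective walk; thus $A',B',C'$ are congruent walks in $H$ with the same endpoints as $A,B,C$. -}

module Defs where

open import Data.Nat using (ℕ; zero; suc)
open import Data.Fin using (Fin; zero; suc; inject₁; fromℕ)
open import Data.Bool using (Bool; true; false; T; if_then_else_)
open import Data.Integer using (ℤ; _+_; _≤_; 0ℤ; 1ℤ; -1ℤ)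
open import Data.Product using (Σ; _×_; _,_)
open import Data.Sum using (_⊎_)
open import Relation.Nullary using (¬_)
open import Relation.Binary.PropositionalEquality using (_≡_; _≢_)
open import Relation.Binary.Construct.Closure.Equivalence using (EqClosure)

-- A finite digraph: vertices Fin n, arc relation given by a Boolean adjacency
-- (loops allowed, no multiple arcs).
record Digraph : Set where
  field
    size : ℕ
    arc  : Fin size → Fin size → Bool

open Digraph public

V : Digraph → Set
V H = Fin (size H)

Arc : (H : Digraph) → V H → V H → Set
Arc H x y = T (arc H x y)

-- A walk w_0,…,w_m: vertices indexed by Fin (suc m), a designated direction
-- for each step (true = forward, false = backward), and validity of each step.
record Walk (H : Digraph) (m : ℕ) : Set where
  field
    vert  : Fin (suc m) → V H
    dir   : Fin m → Bool
    valid : (i : Fin m) →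
      if dir i then Arc H (vert (inject₁ i)) (vert (suc i))
               else Arc H (vert (suc i)) (vert (inject₁ i))

open Walk public

stepNet : Bool → ℤ
stepNet true  = 1ℤ
stepNet false = -1ℤ

prefixNet : ∀ {m} → (Fin m → Bool) → Fin (suc m) → ℤ
prefixNet d zero = 0ℤ
prefixNet {suc m} d (suc i) = stepNet (d zero) + prefixNet (λ j → d (suc j)) i

netLength : ∀ {H m} → Walk H m → ℤ
netLength {m = m} W = prefixNet (dir W) (fromℕ m)

Constricted : ∀ {H m} → Walk H m → Set
Constricted W = (i : Fin _) →
  (0ℤ ≤ prefixNet (dir W) i) × (prefixNet (dir W) i ≤ netLength W)

Congruent : ∀ {H m} → Walk H m → Walk H m → Set
Congruent P Q = (i : Fin _) → dir P i ≡ dir Q i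

FaithfulArc : ∀ {H m} → Walk H m → Walk H m → Fin m → Set
FaithfulArc {H} P Q i =
  if dir P i then Arc H (vert P (inject₁ i)) (vert Q (suc i))
             else Arc H (vert Q (suc i)) (vert P (inject₁ i))

Avoid : ∀ {H m} → Walk H m → Walk H m → Set
Avoid P Q = (i : Fin _) → ¬ (FaithfulArc P Q i × FaithfulArc Q P i)

StarArc : (H : Digraph) → V H × V H → V H × V H → Set
StarArc H (x , y) (x' , y') =
  x ≢ y × x' ≢ y' × Arc H x x' × Arc H y y' × ¬ (Arc H x y' × Arc H y x')

WeaklyConnectedStar : (H : Digraph) → V H × V H → V H × V H → Set
WeaklyConnectedStar H = EqClosure (StarArc H)

-- arc u → v of the oriented path Ŵ determined by a direction sequence d
HatArc : ∀ {m} → (Fin m → Bool) → Fin (suc m) → Fin (suc m) → Set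
HatArc {m} d u v = Σ (Fin m) λ j →
    (u ≡ inject₁ j × v ≡ suc j × d j ≡ true)
  ⊎ (u ≡ suc j × v ≡ inject₁ j × d j ≡ false)

-- homomorphism of the oriented path S (direction sequence dS, t steps)
-- to Ŵ, mapping first to first and last to last vertex
EndpointHom : ∀ {t m} → (Fin t → Bool) → (Fin m → Bool) →
              (Fin (suc t) → Fin (suc m)) → Set
EndpointHom {t} {m} dS dW φ =
  ((i : Fin t) → HatArc dS (inject₁ i) (suc i) → HatArc dW (φ (inject₁ i)) (φ (suc i)))
  × ((i : Fin t) → HatArc dS (suc i) (inject₁ i) → HatArc dW (φ (suc i)) (φ (inject₁ i)))
  × φ zero ≡ zero × φ (fromℕ t) ≡ fromℕ m

PreImage : ∀ {H t m} → (Fin t → Bool) → Walk H m → (Fin (suc t) → Fin (suc m)) →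
           Walk H t → Set
PreImage dS W φ W' =
  ((i : Fin _) → dir W' i ≡ dS i) × ((i : Fin _) → vert W' i ≡ vert W (φ i))

-- Two constricted walks of the same net length have
--     congruent common pre-images.  We encode a direction sequence by its
--     height profile and build, by induction on the total length, a zigzag:
--     a sequence of simultaneous moves along the oriented paths Â and Ĉ, in
--     matching directions, from their first to their last vertices.  If
--     neither profile has a peak (a forward step followed by a backward one)
--     both are straight and are walked in parallel.  Otherwise some profile
--     has a good peak, one whose base level is not the summit level of a peak
--     of the other profile; we fold it away, recurse, and lift the zigzag back
--     by detouring over the folded peak.  B reuses the pre-image map of A.
--
-- Let K be the weak component of H* containing (a,b).
--     Each step of the mutually avoiding pair A',B' is an arc of H*, so all
--     their pairs lie in K.  The condition "(x,z) ∉ K and (z,y) ∉ K" on the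
--     triple (x,y,z) of current vertices of A',B',C' survives every step, and
--     at each step it forbids both crossings between C' and A' or B'.
module Submission where

open import Defs
open import Data.Nat as ℕ using (ℕ; zero; suc; z≤n; s≤s)
import Data.Nat.Properties as ℕP
open import Data.Integer as ℤ using (ℤ; +_; ∣_∣; 0ℤ; 1ℤ; -1ℤ)
import Data.Integer.Properties as ℤP
open import Data.Fin using (Fin; zero; suc; inject₁; fromℕ; fromℕ<; toℕ)
import Data.Fin.Properties as FinP
open import Data.Fin.Induction using (<-weakInduction)
open import Data.List using (List; []; _∷_; length; lookup)
open import Data.Bool using (Bool; true; false; if_then_else_)
import Data.Bool.Properties as BoolP
open import Data.Product using (Σ; ∃; _×_; _,_; proj₁; proj₂)
open import Data.Sum using (_⊎_; inj₁; inj₂; swap)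
open import Data.Empty using (⊥; ⊥-elim)
open import Relation.Nullary using (¬_; Dec; yes; no)
open import Relation.Nullary.Decidable using (_×-dec_; map′)
open import Relation.Binary using (tri<; tri≈; tri>)
open import Relation.Binary.PropositionalEquality
open import Relation.Binary.Construct.Closure.ReflexiveTransitive using (ε; _◅_; _◅◅_)
open import Relation.Binary.Construct.Closure.Symmetric using (fwd; bwd)

+1-1 : ∀ i → (i ℤ.+ 1ℤ) ℤ.+ -1ℤ ≡ i
+1-1 i = trans (ℤP.+-assoc i 1ℤ -1ℤ) (ℤP.+-identityʳ i)

-1+1 : ∀ i → (i ℤ.+ -1ℤ) ℤ.+ 1ℤ ≡ i
-1+1 i = trans (ℤP.+-assoc i -1ℤ 1ℤ) (ℤP.+-identityʳ i)

+1-injective : ∀ {i j} → i ℤ.+ 1ℤ ≡ j ℤ.+ 1ℤ → i ≡ j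
+1-injective {i} {j} e = begin
  i                   ≡⟨ +1-1 i ⟨
  (i ℤ.+ 1ℤ) ℤ.+ -1ℤ  ≡⟨ cong (ℤ._+ -1ℤ) e ⟩
  (j ℤ.+ 1ℤ) ℤ.+ -1ℤ  ≡⟨ +1-1 j ⟩
  j                   ∎
  where open ≡-Reasoning

+-suc : ∀ n → + n ℤ.+ 1ℤ ≡ + suc n
+-suc n = cong +_ (ℕP.+-comm n 1)

i+1≰i : ∀ i → ¬ (i ℤ.+ 1ℤ ℤ.≤ i)
i+1≰i i p = ℤP.i≮i (ℤP.suc[i]≤j⇒i<j (subst (ℤ._≤ i) (ℤP.+-comm i 1ℤ) p))

nonneg+1≢0 : ∀ {i} → 0ℤ ℤ.≤ i → i ℤ.+ 1ℤ ≢ 0ℤ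
nonneg+1≢0 {i} i≥0 e =
  ℕP.1+n≢0 (ℤP.+-injective (trans (sym (+-suc ∣ i ∣)) (trans (cong (ℤ._+ 1ℤ) (ℤP.0≤i⇒+∣i∣≡i i≥0)) e)))

-- A direction sequence indexed by ℕ (true = forward); only an initial
-- segment of it is ever relevant.
Profile : Set
Profile = ℕ → Bool

height : Profile → ℕ → ℤ
height d zero    = 0ℤ
height d (suc x) = height d x ℤ.+ stepNet (d x)

height-step : ∀ d d' x y → height d x ≡ height d' y → d x ≡ d' y →
              height d (suc x) ≡ height d' (suc y)
height-step d d' x y = cong₂ (λ h s → h ℤ.+ stepNet s)

-- The arcs of the oriented path d̂ on {0,…,m}; every arc climbs one level.
data PathArc (m : ℕ) (d : Profile) : ℕ → ℕ → Set where
  forward  : ∀ {j} → j ℕ.< m → d j ≡ true  → PathArc m d j (suc j)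
  backward : ∀ {j} → j ℕ.< m → d j ≡ false → PathArc m d (suc j) j

Move : ℕ → Profile → Bool → ℕ → ℕ → Set
Move m d b x x' = if b then PathArc m d x x' else PathArc m d x' x

arc-bounded : ∀ {m d u v} → PathArc m d u v → (u ℕ.≤ m) × (v ℕ.≤ m)
arc-bounded (forward j<m _)  = ℕP.<⇒≤ j<m , j<m
arc-bounded (backward j<m _) = j<m , ℕP.<⇒≤ j<m

move-bounded : ∀ {m d} b {x x'} → Move m d b x x' → (x ℕ.≤ m) × (x' ℕ.≤ m)
move-bounded true  h = arc-bounded h
move-bounded false h = let (v≤m , u≤m) = arc-bounded h in u≤m , v≤m

arc-climbs : ∀ {m d u v} → PathArc m d u v → height d v ≡ height d u ℤ.+ 1ℤ
arc-climbs {d = d} (forward {j} _ e) = cong (λ s → height d j ℤ.+ stepNet s) e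
arc-climbs {d = d} (backward {j} _ e) =
  sym (trans (cong (λ s → (height d j ℤ.+ stepNet s) ℤ.+ 1ℤ) e) (-1+1 (height d j)))

moves-agree : ∀ {m₁ d₁ m₂ d₂} b {x x' y y'} →
  Move m₁ d₁ b x x' → Move m₂ d₂ b y y' → height d₁ x ≡ height d₂ y → height d₁ x' ≡ height d₂ y'
moves-agree true  h₁ h₂ e = trans (arc-climbs h₁) (trans (cong (ℤ._+ 1ℤ) e) (sym (arc-climbs h₂)))
moves-agree false h₁ h₂ e = +1-injective (trans (sym (arc-climbs h₁)) (trans e (arc-climbs h₂)))

data Track (m : ℕ) (d : Profile) : List Bool → ℕ → Set where
  arrive : Track m d [] m
  step   : ∀ b {bs x x'} → Move m d b x x' → Track m d bs x' → Track m d (b ∷ bs) x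

-- Two tracks with the same directions: a common pre-image, in profile form.
Zigzag : ℕ → Profile → ℕ → Profile → ℕ → ℕ → Set
Zigzag m₁ d₁ m₂ d₂ x y = Σ (List Bool) λ bs → Track m₁ d₁ bs x × Track m₂ d₂ bs y

zstep : ∀ {m₁ d₁ m₂ d₂ x y x' y'} b → Move m₁ d₁ b x x' → Move m₂ d₂ b y y' →
        Zigzag m₁ d₁ m₂ d₂ x' y' → Zigzag m₁ d₁ m₂ d₂ x y
zstep b h₁ h₂ (bs , t₁ , t₂) = b ∷ bs , step b h₁ t₁ , step b h₂ t₂

zswap : ∀ {m₁ d₁ m₂ d₂ x y} → Zigzag m₁ d₁ m₂ d₂ x y → Zigzag m₂ d₂ m₁ d₁ y x
zswap (bs , t₁ , t₂) = bs , t₂ , t₁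

-- The profile of a constricted walk of length m and net length N.
record Mountain (m : ℕ) (d : Profile) (N : ℤ) : Set where
  constructor mountain
  field
    within : ∀ x → x ℕ.≤ m → (0ℤ ℤ.≤ height d x) × (height d x ℤ.≤ N)
    summit : height d m ≡ N
open Mountain

above-ground : ∀ {m d N} → Mountain m d N → ∀ x → x ℕ.≤ m → 0ℤ ℤ.≤ height d x
above-ground c x x≤m = proj₁ (within c x x≤m)

record Peak (m : ℕ) (d : Profile) (q : ℕ) : Set where
  constructor peak
  field
    fits : suc (suc q) ℕ.≤ m
    up   : d q ≡ true
    down : d (suc q) ≡ false
open Peak

NoPeak : ℕ → Profile → Set
NoPeak m d = ∀ q → ¬ Peak m d q

peak? : ∀ m d q → Dec (Peak m d q)
peak? m d q = map′ (λ (f , u , w) → peak f u w) (λ (peak f u w) → f , u , w)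
  ((suc (suc q) ℕ.≤? m) ×-dec (d q BoolP.≟ true) ×-dec (d (suc q) BoolP.≟ false))

peak-bounded : ∀ {m d q} → Peak m d q → q ℕ.< m
peak-bounded pk = ℕP.<-trans (ℕP.n<1+n _) (fits pk)

summit-of-peak : ∀ {m d q} → Peak m d q → height d (suc q) ≡ height d q ℤ.+ 1ℤ
summit-of-peak {d = d} {q} pk = cong (λ s → height d q ℤ.+ stepNet s) (up pk)

base-of-peak : ∀ {m d q} → Peak m d q → height d (suc (suc q)) ≡ height d q
base-of-peak {d = d} {q} pk =
  trans (cong₂ (λ h s → h ℤ.+ stepNet s) (summit-of-peak pk) (down pk)) (+1-1 (height d q))

peak-below-summit : ∀ {m d N q} → Mountain m d N → Peak m d q → height d q ≢ N
peak-below-summit {d = d} {q = q} c pk e =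
  i+1≰i (height d q) (subst₂ ℤ._≤_ (summit-of-peak pk) (sym e)
    (proj₂ (within c (suc q) (ℕP.<⇒≤ (fits pk)))))

peak-not-final : ∀ {m d N q} → Mountain m d N → Peak m d q → suc (suc q) ≢ m
peak-not-final c pk refl = peak-below-summit c pk (trans (sym (base-of-peak pk)) (summit c))

-- Heights stay non-negative, so a mountain starts with a forward step.
first-step-up : ∀ {m d N} → Mountain m d N → 0 ℕ.< m → d 0 ≡ true
first-step-up {d = d} c 0<m with d 0 | above-ground c 1 0<m
... | true  | _  = refl
... | false | ()

all-forward : ∀ {m d N} → Mountain m d N → NoPeak m d → ∀ x → x ℕ.< m → d x ≡ true
all-forward c noPeak zero    0<m = first-step-up c 0<m
all-forward {d = d} c noPeak (suc x) x<m with d (suc x) in down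
... | true  = refl
... | false = ⊥-elim (noPeak x (peak x<m (all-forward c noPeak x (ℕP.<-trans (ℕP.n<1+n x) x<m)) down))

straight-height : ∀ {m d} → (∀ x → x ℕ.< m → d x ≡ true) → ∀ x → x ℕ.≤ m → height d x ≡ + x
straight-height fw zero    _   = refl
straight-height fw (suc x) x<m =
  trans (cong₂ (λ h s → h ℤ.+ stepNet s) (straight-height fw x (ℕP.<⇒≤ x<m)) (fw x x<m)) (+-suc x)

parallel : ∀ {m d₁ d₂} → (∀ x → x ℕ.< m → d₁ x ≡ true) → (∀ x → x ℕ.< m → d₂ x ≡ true) →
  ∀ r x → x ℕ.+ r ≡ m → Zigzag m d₁ m d₂ x x
parallel fw₁ fw₂ zero x refl rewrite ℕP.+-identityʳ x = [] , arrive , arrive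
parallel {m} fw₁ fw₂ (suc r) x e =
  zstep true (forward x<m (fw₁ x x<m)) (forward x<m (fw₂ x x<m))
    (parallel fw₁ fw₂ r (suc x) (trans (sym (ℕP.+-suc x r)) e))
  where
  x<m : x ℕ.< m
  x<m = subst (x ℕ.<_) e (ℕP.m<m+n x (s≤s z≤n))

-- Two peakless mountains of the same summit are straight of the same length.
flat-zigzag : ∀ {mA dA mB dB N} → Mountain mA dA N → Mountain mB dB N →
  NoPeak mA dA → NoPeak mB dB → Zigzag mA dA mB dB 0 0
flat-zigzag {mA} {dA} {mB} {dB} cA cB npA npB =
  subst (λ m → Zigzag mA dA m dB 0 0) same-length (parallel fwA fwB mA 0 refl)
  where
  same-length : mA ≡ mB
  same-length = ℤP.+-injective (begin
    + mA          ≡⟨ straight-height (all-forward cA npA) mA ℕP.≤-refl ⟨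
    height dA mA  ≡⟨ trans (summit cA) (sym (summit cB)) ⟩
    height dB mB  ≡⟨ straight-height (all-forward cB npB) mB ℕP.≤-refl ⟩
    + mB          ∎)
    where open ≡-Reasoning
  fwA = all-forward cA npA
  fwB : ∀ x → x ℕ.< mA → dB x ≡ true
  fwB x x<mA = all-forward cB npB x (subst (x ℕ.<_) same-length x<mA)

-- Deleting the steps q and q+1 from a profile of length n+2; positions of the
-- folded path re-enter the original one through embed.
module Fold (n : ℕ) (d : Profile) (q : ℕ) where
  m : ℕ
  m = suc (suc n)

  folded : Profile
  folded x with x ℕ.<? q
  ... | yes _ = d x
  ... | no  _ = d (suc (suc x))

  embed : ℕ → ℕ
  embed x with x ℕ.≤? q
  ... | yes _ = x
  ... | no  _ = suc (suc x)

  folded-below : ∀ {x} → x ℕ.< q → folded x ≡ d x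
  folded-below {x} x<q with x ℕ.<? q
  ... | yes _   = refl
  ... | no  x≮q = ⊥-elim (x≮q x<q)

  folded-above : ∀ {x} → q ℕ.≤ x → folded x ≡ d (suc (suc x))
  folded-above {x} q≤x with x ℕ.<? q
  ... | yes x<q = ⊥-elim (ℕP.<⇒≱ x<q q≤x)
  ... | no  _   = refl

  embed-below : ∀ {x} → x ℕ.≤ q → embed x ≡ x
  embed-below {x} x≤q with x ℕ.≤? q
  ... | yes _   = refl
  ... | no  x≰q = ⊥-elim (x≰q x≤q)

  embed-above : ∀ {x} → q ℕ.< x → embed x ≡ suc (suc x)
  embed-above {x} q<x with x ℕ.≤? q
  ... | yes x≤q = ⊥-elim (ℕP.<⇒≱ q<x x≤q)
  ... | no  _   = refl

  module _ (pk : Peak m d q) where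

    height-folded : ∀ x → height folded x ≡ height d (embed x)
    height-folded zero = sym (cong (height d) (embed-below z≤n))
    height-folded (suc x) with ℕP.<-cmp x q
    ... | tri< x<q _ _ =
      trans (height-step folded d x x before (folded-below x<q)) (cong (height d) (sym (embed-below x<q)))
      where
      before : height folded x ≡ height d x
      before = trans (height-folded x) (cong (height d) (embed-below (ℕP.<⇒≤ x<q)))
    ... | tri≈ _ refl _ =
      trans (height-step folded d x (suc (suc x)) at-base (folded-above ℕP.≤-refl))
            (cong (height d) (sym (embed-above (ℕP.n<1+n x))))
      where
      at-base : height folded x ≡ height d (suc (suc x))
      at-base = trans (height-folded x) (trans (cong (height d) (embed-below ℕP.≤-refl)) (sym (base-of-peak pk)))
    ... | tri> _ _ q<x =
      trans (height-step folded d x (suc (suc x)) beyond (folded-above (ℕP.<⇒≤ q<x)))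
            (cong (height d) (sym (embed-above (ℕP.m<n⇒m<1+n q<x))))
      where
      beyond : height folded x ≡ height d (suc (suc x))
      beyond = trans (height-folded x) (cong (height d) (embed-above q<x))

    module _ (q<n : q ℕ.< n) where

      q<m : q ℕ.< m
      q<m = ℕP.<-trans q<n (ℕP.<-trans (ℕP.n<1+n _) (ℕP.n<1+n _))

      1+q<m : suc q ℕ.< m
      1+q<m = s≤s (ℕP.<-trans q<n (ℕP.n<1+n _))

      embed-bounded : ∀ x → x ℕ.≤ n → embed x ℕ.≤ m
      embed-bounded x x≤n with x ℕ.≤? q
      ... | yes _ = ℕP.≤-trans x≤n (ℕP.≤-trans (ℕP.n≤1+n _) (ℕP.n≤1+n _))
      ... | no  _ = s≤s (s≤s x≤n)

      folded-mountain : ∀ {N} → Mountain m d N → Mountain n folded N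
      folded-mountain {N} c = mountain
        (λ x x≤n → subst (λ h → (0ℤ ℤ.≤ h) × (h ℤ.≤ N)) (sym (height-folded x))
                         (within c (embed x) (embed-bounded x x≤n)))
        (trans (height-folded n) (trans (cong (height d) (embed-above q<n)) (summit c)))

      -- A move of the folded path that crosses between q and q+1 corresponds
      -- to the move of the original path between q+2 and q+3.
      Crosses : Bool → ℕ → ℕ → Set
      Crosses b x x' = (x ≡ q × x' ≡ suc q × Move m d b (suc (suc q)) (suc (suc (suc q))))
                      ⊎ (x ≡ suc q × x' ≡ q × Move m d b (suc (suc (suc q))) (suc (suc q)))

      classify-arc : ∀ {u v} → PathArc n folded u v → PathArc m d (embed u) (embed v) ⊎ Crosses true u v
      classify-arc (forward {j} j<n e) with ℕP.<-cmp j q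
      ... | tri< j<q _ _ rewrite embed-below (ℕP.<⇒≤ j<q) | embed-below j<q =
            inj₁ (forward (ℕP.<-trans j<q q<m) (trans (sym (folded-below j<q)) e))
      ... | tri≈ _ refl _ = inj₂ (inj₁ (refl , refl , forward (s≤s (s≤s j<n)) (trans (sym (folded-above ℕP.≤-refl)) e)))
      ... | tri> _ _ q<j rewrite embed-above q<j | embed-above (ℕP.m<n⇒m<1+n q<j) =
            inj₁ (forward (s≤s (s≤s j<n)) (trans (sym (folded-above (ℕP.<⇒≤ q<j))) e))
      classify-arc (backward {j} j<n e) with ℕP.<-cmp j q
      ... | tri< j<q _ _ rewrite embed-below (ℕP.<⇒≤ j<q) | embed-below j<q =
            inj₁ (backward (ℕP.<-trans j<q q<m) (trans (sym (folded-below j<q)) e))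
      ... | tri≈ _ refl _ = inj₂ (inj₂ (refl , refl , backward (s≤s (s≤s j<n)) (trans (sym (folded-above ℕP.≤-refl)) e)))
      ... | tri> _ _ q<j rewrite embed-above q<j | embed-above (ℕP.m<n⇒m<1+n q<j) =
            inj₁ (backward (s≤s (s≤s j<n)) (trans (sym (folded-above (ℕP.<⇒≤ q<j))) e))

      classify : ∀ b {x x'} → Move n folded b x x' → Move m d b (embed x) (embed x') ⊎ Crosses b x x'
      classify true h = classify-arc h
      classify false h with classify-arc h
      ... | inj₁ h'                      = inj₁ h'
      ... | inj₂ (inj₁ (refl , refl , h')) = inj₂ (inj₂ (refl , refl , h'))
      ... | inj₂ (inj₂ (refl , refl , h')) = inj₂ (inj₁ (refl , refl , h'))

      -- Lifting a zigzag against a second profile d₂ in which every vertex at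
      -- the base level of the peak can climb one level (escape).
      module Lift (m₂ : ℕ) (d₂ : Profile)
                  (escape : ∀ y → y ℕ.≤ m₂ → height d₂ y ≡ height d q → Σ ℕ (PathArc m₂ d₂ y)) where

        -- the first walk goes over the peak while the second climbs and returns
        over-peak : ∀ b {y y'} → Move m d b (suc (suc q)) (suc (suc (suc q))) → Move m₂ d₂ b y y' →
          Σ ℕ (PathArc m₂ d₂ y) → Zigzag m d m₂ d₂ (suc (suc (suc q))) y' → Zigzag m d m₂ d₂ q y
        over-peak b h h₂ (_ , climb) rest =
          zstep true (forward q<m (up pk)) climb
            (zstep false (backward 1+q<m (down pk)) climb (zstep b h h₂ rest))

        back-over-peak : ∀ b {y y'} → Move m d b (suc (suc (suc q))) (suc (suc q)) → Move m₂ d₂ b y y' →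
          Σ ℕ (PathArc m₂ d₂ y') → Zigzag m d m₂ d₂ q y' → Zigzag m d m₂ d₂ (suc (suc (suc q))) y
        back-over-peak b h h₂ (_ , climb) rest =
          zstep b h h₂ (zstep true (backward 1+q<m (down pk)) climb
            (zstep false (forward q<m (up pk)) climb rest))

        height-base : height folded q ≡ height d q
        height-base = trans (height-folded q) (cong (height d) (embed-below ℕP.≤-refl))

        embed-base : embed q ≡ q
        embed-base = embed-below ℕP.≤-refl

        embed-beyond : embed (suc q) ≡ suc (suc (suc q))
        embed-beyond = embed-above (ℕP.n<1+n q)

        from : ∀ {x x' y} → x ≡ x' → Zigzag m d m₂ d₂ x y → Zigzag m d m₂ d₂ x' y
        from e = subst (λ x → Zigzag m d m₂ d₂ x _) e

        lift : ∀ {bs x y} → height folded x ≡ height d₂ y →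
               Track n folded bs x → Track m₂ d₂ bs y → Zigzag m d m₂ d₂ (embed x) y
        lift e arrive arrive = from (sym (embed-above q<n)) ([] , arrive , arrive)
        lift e (step b h₁ t₁) (step .b h₂ t₂) with classify b h₁ | lift (moves-agree b h₁ h₂ e) t₁ t₂
        ... | inj₁ h | rest = zstep b h h₂ rest
        ... | inj₂ (inj₁ (refl , refl , h)) | rest =
              from (sym embed-base) (over-peak b h h₂
                (escape _ (proj₁ (move-bounded b h₂)) (trans (sym e) height-base))
                (from embed-beyond rest))
        ... | inj₂ (inj₂ (refl , refl , h)) | rest =
              from (sym embed-beyond) (back-over-peak b h h₂
                (escape _ (proj₂ (move-bounded b h₂)) (trans (sym (moves-agree b h₁ h₂ e)) height-base))
                (from embed-base rest))

        lift-zigzag : Zigzag n folded m₂ d₂ 0 0 → Zigzag m d m₂ d₂ 0 0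
        lift-zigzag (_ , t₁ , t₂) = from (embed-below z≤n) (lift refl t₁ t₂)

GoodPeak : ℕ → Profile → ℕ → Profile → Set
GoodPeak mA dA mB dB =
  Σ ℕ λ q → Peak mA dA q × (∀ q₂ → Peak mB dB q₂ → height dB (suc q₂) ≢ height dA q)

summit-at? : ∀ m d h → Dec (∃ λ q → q ℕ.< m × Peak m d q × height d (suc q) ≡ h)
summit-at? m d h = ℕP.anyUpTo? (λ q → peak? m d q ×-dec (height d (suc q) ℤP.≟ h)) m

-- If a peak of A is not good, some peak of B sits one level lower; since
-- heights are non-negative this descent stops at a good peak.
descend : ∀ level {mA dA mB dB N} → Mountain mA dA N → Mountain mB dB N →
  ∀ q → Peak mA dA q → height dA q ≡ + level → GoodPeak mA dA mB dB ⊎ GoodPeak mB dB mA dA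
descend level {mB = mB} {dB} cA cB q pk e with summit-at? mB dB (+ level)
... | no none = inj₁ (q , pk , λ q₂ pk₂ e₂ → none (q₂ , peak-bounded pk₂ , pk₂ , trans e₂ e))
descend zero {dB = dB} cA cB q pk e | yes (q₂ , _ , pk₂ , e₂) =
  ⊥-elim (nonneg+1≢0 (above-ground cB q₂ (ℕP.<⇒≤ (peak-bounded pk₂))) (trans (sym (summit-of-peak pk₂)) e₂))
descend (suc level) cA cB q pk e | yes (q₂ , _ , pk₂ , e₂) =
  swap (descend level cB cA q₂ pk₂
    (+1-injective (trans (sym (summit-of-peak pk₂)) (trans e₂ (sym (+-suc level))))))

escape : ∀ {mA dA mB dB N} → Mountain mA dA N → Mountain mB dB N → (g : GoodPeak mA dA mB dB) →
  ∀ y → y ℕ.≤ mB → height dB y ≡ height dA (proj₁ g) → Σ ℕ (PathArc mB dB y)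
escape {dB = dB} cA cB (q , pk , good) y y≤mB level with ℕP.m≤n⇒m<n∨m≡n y≤mB
... | inj₂ refl = ⊥-elim (peak-below-summit cA pk (trans (sym level) (summit cB)))
... | inj₁ y<mB with dB y in step-y
...   | true = suc y , forward y<mB step-y
escape {dB = dB} cA cB (q , pk , good) zero y≤mB level | inj₁ y<mB | false
  with () ← trans (sym step-y) (first-step-up cB y<mB)
escape {dB = dB} cA cB (q , pk , good) (suc y) y≤mB level | inj₁ y<mB | false with dB y in step-before
... | false = y , backward (ℕP.<-trans (ℕP.n<1+n y) y<mB) step-before
... | true  = ⊥-elim (good y (peak y<mB step-before step-y)
                         (trans (cong (λ s → height dB y ℤ.+ stepNet s) step-before) level))

good-peak-from : ∀ {mA dA mB dB N} → Mountain mA dA N → Mountain mB dB N →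
  ∀ q → Peak mA dA q → GoodPeak mA dA mB dB ⊎ GoodPeak mB dB mA dA
good-peak-from {dA = dA} cA cB q pk =
  descend ∣ height dA q ∣ cA cB q pk (sym (ℤP.0≤i⇒+∣i∣≡i (above-ground cA q (ℕP.<⇒≤ (peak-bounded pk)))))

good-peak-or-flat : ∀ {mA dA mB dB N} → Mountain mA dA N → Mountain mB dB N →
  (GoodPeak mA dA mB dB ⊎ GoodPeak mB dB mA dA) ⊎ (NoPeak mA dA × NoPeak mB dB)
good-peak-or-flat {mA} {dA} {mB} {dB} cA cB
  with ℕP.anyUpTo? (peak? mA dA) mA | ℕP.anyUpTo? (peak? mB dB) mB
... | yes (q , _ , pk) | _                = inj₁ (good-peak-from cA cB q pk)
... | no _             | yes (q , _ , pk) = inj₁ (swap (good-peak-from cB cA q pk))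
... | no noA           | no noB           = inj₂ (no-peak noA , no-peak noB)
  where
  no-peak : ∀ {m d} → ¬ (∃ λ q → q ℕ.< m × Peak m d q) → NoPeak m d
  no-peak none q pk = none (q , peak-bounded pk , pk)

fold-good-peak : ∀ {n dA mB dB N} → GoodPeak (suc (suc n)) dA mB dB →
  Mountain (suc (suc n)) dA N → Mountain mB dB N →
  (∀ {d} → Mountain n d N → Zigzag n d mB dB 0 0) → Zigzag (suc (suc n)) dA mB dB 0 0
fold-good-peak {n} {dA} {mB} {dB} g@(q , pk , _) cA cB shorter =
  lift-zigzag (shorter (folded-mountain pk q<n cA))
  where
  open Fold n dA q
  q<n : q ℕ.< n
  q<n = ℕP.≤∧≢⇒< (ℕP.≤-pred (ℕP.≤-pred (fits pk))) (λ { refl → peak-not-final cA pk refl })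
  open Lift pk q<n mB dB (escape cA cB g)

shorter-by-two : ∀ n m' {fuel} → suc (suc n) ℕ.+ m' ℕ.≤ suc fuel → n ℕ.+ m' ℕ.≤ fuel
shorter-by-two n m' bnd = ℕP.≤-trans (ℕP.n≤1+n _) (ℕP.≤-pred bnd)

-- Any two mountains of the same summit have a common pre-image
-- (induction on the total length, bounded by fuel; a peak needs length ≥ 2,
-- so with no fuel left there is none).
climb : ∀ fuel {mA dA mB dB N} → mA ℕ.+ mB ℕ.≤ fuel →
        Mountain mA dA N → Mountain mB dB N → Zigzag mA dA mB dB 0 0
climb fuel bnd cA cB with good-peak-or-flat cA cB
... | inj₂ (noA , noB) = flat-zigzag cA cB noA noB
climb zero () cA cB | inj₁ (inj₁ (_ , peak (s≤s (s≤s _)) _ _ , _))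
climb zero {mA} bnd cA cB | inj₁ (inj₂ (_ , peak (s≤s (s≤s _)) _ _ , _)) with () ← ℕP.m+n≤o⇒n≤o mA bnd
climb (suc fuel) {mB = mB} bnd cA cB | inj₁ (inj₁ g@(_ , peak (s≤s (s≤s {n = n} _)) _ _ , _)) =
  fold-good-peak g cA cB (λ c → climb fuel (shorter-by-two n mB bnd) c cB)
climb (suc fuel) {mA} {mB = mB} bnd cA cB | inj₁ (inj₂ g@(_ , peak (s≤s (s≤s {n = n} _)) _ _ , _)) =
  zswap (fold-good-peak g cB cA
    (λ c → climb fuel (shorter-by-two n mA (subst (ℕ._≤ suc fuel) (ℕP.+-comm mA mB) bnd)) c cA))

-- The profile of a direction sequence of length m (padded arbitrarily).
profile : (m : ℕ) → (Fin m → Bool) → Profile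
profile zero    d x       = false
profile (suc m) d zero    = d zero
profile (suc m) d (suc x) = profile m (λ j → d (suc j)) x

profile-toℕ : ∀ {m} (d : Fin m → Bool) (i : Fin m) → profile m d (toℕ i) ≡ d i
profile-toℕ d zero    = refl
profile-toℕ d (suc i) = profile-toℕ (λ j → d (suc j)) i

height-shift : ∀ d x → height d (suc x) ≡ stepNet (d 0) ℤ.+ height (λ y → d (suc y)) x
height-shift d zero    = ℤP.+-comm 0ℤ (stepNet (d 0))
height-shift d (suc x) =
  trans (cong (ℤ._+ stepNet (d (suc x))) (height-shift d x))
        (ℤP.+-assoc (stepNet (d 0)) (height (λ y → d (suc y)) x) _)

height-profile : ∀ m (d : Fin m → Bool) (i : Fin (suc m)) → height (profile m d) (toℕ i) ≡ prefixNet d i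
height-profile m       d zero    = refl
height-profile (suc m) d (suc i) =
  trans (height-shift (profile (suc m) d) (toℕ i))
        (cong (λ h → stepNet (d zero) ℤ.+ h) (height-profile m (λ j → d (suc j)) i))

constricted-mountain : ∀ {H m} (W : Walk H m) → Constricted W → Mountain m (profile m (dir W)) (netLength W)
constricted-mountain {m = m} W c = mountain bounds (height-at (fromℕ m) (FinP.toℕ-fromℕ m))
  where
  height-at : ∀ i {x} → toℕ i ≡ x → height (profile m (dir W)) x ≡ prefixNet (dir W) i
  height-at i refl = height-profile m (dir W) i
  bounds : ∀ x → x ℕ.≤ m → (0ℤ ℤ.≤ height (profile m (dir W)) x) × (height (profile m (dir W)) x ℤ.≤ netLength W)
  bounds x x≤m = subst (λ h → (0ℤ ℤ.≤ h) × (h ℤ.≤ netLength W))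
    (sym (height-at (fromℕ< (s≤s x≤m)) (FinP.toℕ-fromℕ< (s≤s x≤m)))) (c (fromℕ< (s≤s x≤m)))

OrientedArc : ∀ {m} → (Fin m → Bool) → Bool → Fin (suc m) → Fin (suc m) → Set
OrientedArc d b u v = if b then HatArc d u v else HatArc d v u

StepHom : ∀ {t m} → (Fin t → Bool) → (Fin m → Bool) → (Fin (suc t) → Fin (suc m)) → Set
StepHom dS d φ = ∀ i → OrientedArc d (dS i) (φ (inject₁ i)) (φ (suc i))

record PathMap {t m : ℕ} (dS : Fin t → Bool) (d : Fin m → Bool) : Set where
  field
    map   : Fin (suc t) → Fin (suc m)
    steps : StepHom dS d map
    start : map zero ≡ zero
    end   : map (fromℕ t) ≡ fromℕ m
open PathMap

arc→HatArc : ∀ {m} {d : Fin m → Bool} {x y} → PathArc m (profile m d) x y →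
  (u v : Fin (suc m)) → toℕ u ≡ x → toℕ v ≡ y → HatArc d u v
arc→HatArc {m} {d} (forward {j} j<m e) u v refl ev =
  fromℕ< j<m , inj₁ (FinP.toℕ-injective (sym (trans (FinP.toℕ-inject₁ _) (FinP.toℕ-fromℕ< j<m))) ,
                     FinP.toℕ-injective (trans ev (cong suc (sym (FinP.toℕ-fromℕ< j<m)))) ,
                     trans (sym (profile-toℕ d _)) (trans (cong (profile m d) (FinP.toℕ-fromℕ< j<m)) e))
arc→HatArc {m} {d} (backward {j} j<m e) u v eu refl =
  fromℕ< j<m , inj₂ (FinP.toℕ-injective (trans eu (cong suc (sym (FinP.toℕ-fromℕ< j<m)))) ,
                     FinP.toℕ-injective (sym (trans (FinP.toℕ-inject₁ _) (FinP.toℕ-fromℕ< j<m))) ,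
                     trans (sym (profile-toℕ d _)) (trans (cong (profile m d) (FinP.toℕ-fromℕ< j<m)) e))

move→OrientedArc : ∀ {m} {d : Fin m → Bool} b {x y} → Move m (profile m d) b x y →
  (u v : Fin (suc m)) → toℕ u ≡ x → toℕ v ≡ y → OrientedArc d b u v
move→OrientedArc true  h u v eu ev = arc→HatArc h u v eu ev
move→OrientedArc false h u v eu ev = arc→HatArc h v u ev eu

module _ {m : ℕ} {d : Fin m → Bool} where

  position : ∀ {bs x} → Track m (profile m d) bs x → Fin (suc (length bs)) → ℕ
  position {x = x} _ zero    = x
  position (step _ _ t) (suc i) = position t i

  position-bounded : ∀ {bs x} (t : Track m (profile m d) bs x) i → position t i ℕ.≤ m
  position-bounded arrive       zero    = ℕP.≤-refl
  position-bounded (step b h t) zero    = proj₁ (move-bounded b h)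
  position-bounded (step _ _ t) (suc i) = position-bounded t i

  position-moves : ∀ {bs x} (t : Track m (profile m d) bs x) (i : Fin (length bs)) →
    Move m (profile m d) (lookup bs i) (position t (inject₁ i)) (position t (suc i))
  position-moves (step b h t) zero    = h
  position-moves (step _ _ t) (suc i) = position-moves t i

  position-end : ∀ {bs x} (t : Track m (profile m d) bs x) → position t (fromℕ (length bs)) ≡ m
  position-end arrive       = refl
  position-end (step _ _ t) = position-end t

  track-map : ∀ {bs} → Track m (profile m d) bs 0 → PathMap (lookup bs) d
  track-map {bs} t = record
    { map   = vertex
    ; steps = λ i → move→OrientedArc (lookup bs i) (position-moves t i) _ _ (at (inject₁ i)) (at (suc i))
    ; start = FinP.toℕ-injective (at zero)
    ; end   = FinP.toℕ-injective (trans (at (fromℕ (length bs))) (trans (position-end t) (sym (FinP.toℕ-fromℕ m))))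
    }
    where
    vertex : Fin (suc (length bs)) → Fin (suc m)
    vertex i = fromℕ< (s≤s (position-bounded t i))
    at : ∀ i → toℕ (vertex i) ≡ position t i
    at i = FinP.toℕ-fromℕ< (s≤s (position-bounded t i))

record CommonPreImage {m k : ℕ} (d₁ : Fin m → Bool) (d₂ : Fin k → Bool) : Set where
  field
    len  : ℕ
    dirs : Fin len → Bool
    map₁ : PathMap dirs d₁
    map₂ : PathMap dirs d₂

common-pre-image : ∀ {H m k} (A : Walk H m) (C : Walk H k) → Constricted A → Constricted C →
  netLength A ≡ netLength C → CommonPreImage (dir A) (dir C)
common-pre-image {m = m} {k} A C cA cC e =
  let (bs , tA , tC) = climb (m ℕ.+ k) ℕP.≤-refl (constricted-mountain A cA)
                         (subst (Mountain k _) (sym e) (constricted-mountain C cC))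
  in record { len = length bs ; dirs = lookup bs ; map₁ = track-map tA ; map₂ = track-map tC }

opposite-steps : ∀ {t} (i j : Fin t) → inject₁ i ≡ suc j → suc i ≡ inject₁ j → ⊥
opposite-steps i j e₁ e₂ = n≢2+n (toℕ j) (trans (sym lower) (cong suc upper))
  where
  upper : toℕ i ≡ suc (toℕ j)
  upper = trans (sym (FinP.toℕ-inject₁ i)) (cong toℕ e₁)
  lower : suc (toℕ i) ≡ toℕ j
  lower = trans (cong toℕ e₂) (FinP.toℕ-inject₁ j)
  n≢2+n : ∀ n → n ≢ suc (suc n)
  n≢2+n zero    ()
  n≢2+n (suc n) e = n≢2+n n (ℕP.suc-injective e)

step-forward : ∀ {t} (dS : Fin t → Bool) i → HatArc dS (inject₁ i) (suc i) → dS i ≡ true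
step-forward dS i (j , inj₁ (e₁ , _ , e)) = subst (λ k → dS k ≡ true) (sym (FinP.inject₁-injective e₁)) e
step-forward dS i (j , inj₂ (e₁ , e₂ , _)) = ⊥-elim (opposite-steps i j e₁ e₂)

step-backward : ∀ {t} (dS : Fin t → Bool) i → HatArc dS (suc i) (inject₁ i) → dS i ≡ false
step-backward dS i (j , inj₁ (e₁ , e₂ , _)) = ⊥-elim (opposite-steps i j e₂ e₁)
step-backward dS i (j , inj₂ (_ , e₂ , e)) = subst (λ k → dS k ≡ false) (sym (FinP.inject₁-injective e₂)) e

endpoint-hom : ∀ {t m} {dS : Fin t → Bool} {d : Fin m → Bool} (P : PathMap dS d) → EndpointHom dS d (map P)
endpoint-hom {dS = dS} {d} P =
  (λ i arc → subst (λ b → OrientedArc d b _ _) (step-forward dS i arc) (steps P i)) ,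
  (λ i arc → subst (λ b → OrientedArc d b _ _) (step-backward dS i arc) (steps P i)) ,
  start P , end P

-- Congruent walks have the same oriented path, hence the same pre-image maps.
congruent-map : ∀ {H t m} {dS : Fin t → Bool} (A B : Walk H m) → Congruent A B →
  PathMap dS (dir A) → PathMap dS (dir B)
congruent-map {dS = dS} A B AB P = record
  { map = map P ; steps = λ i → transfer (dS i) (steps P i) ; start = start P ; end = end P }
  where
  transfer-arc : ∀ {u v} → HatArc (dir A) u v → HatArc (dir B) u v
  transfer-arc (j , inj₁ (e₁ , e₂ , e)) = j , inj₁ (e₁ , e₂ , trans (sym (AB j)) e)
  transfer-arc (j , inj₂ (e₁ , e₂ , e)) = j , inj₂ (e₁ , e₂ , trans (sym (AB j)) e)
  transfer : ∀ b {u v} → OrientedArc (dir A) b u v → OrientedArc (dir B) b u v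
  transfer true  = transfer-arc
  transfer false = transfer-arc

ArcIn : (H : Digraph) → Bool → V H → V H → Set
ArcIn H b x x' = if b then Arc H x x' else Arc H x' x

step-arc : ∀ {H t} (W : Walk H t) i {b} → dir W i ≡ b → ArcIn H b (vert W (inject₁ i)) (vert W (suc i))
step-arc W i refl = valid W i

hat-arc : ∀ {H m} (W : Walk H m) {u v} → HatArc (dir W) u v → Arc H (vert W u) (vert W v)
hat-arc W (j , inj₁ (refl , refl , e)) = step-arc W j e
hat-arc W (j , inj₂ (refl , refl , e)) = step-arc W j e

oriented-arc : ∀ {H m} (W : Walk H m) b {u v} → OrientedArc (dir W) b u v → ArcIn H b (vert W u) (vert W v)
oriented-arc W true  = hat-arc W
oriented-arc W false = hat-arc W

pullback : ∀ {H t m} {dS : Fin t → Bool} (W : Walk H m) → PathMap dS (dir W) → Walk H t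
pullback {dS = dS} W P = record
  { vert  = λ s → vert W (map P s)
  ; dir   = dS
  ; valid = λ i → oriented-arc W (dS i) (steps P i) }

pullback-pre-image : ∀ {H t m} {dS : Fin t → Bool} (W : Walk H m) (P : PathMap dS (dir W)) →
  PreImage dS W (map P) (pullback W P)
pullback-pre-image W P = (λ _ → refl) , (λ _ → refl)

pullback-start : ∀ {H t m} {dS : Fin t → Bool} (W : Walk H m) (P : PathMap dS (dir W)) {w} →
  vert W zero ≡ w → vert (pullback W P) zero ≡ w
pullback-start W P = trans (cong (vert W) (start P))

Crossing : (H : Digraph) → V H → V H → V H → V H → Set
Crossing H x z x' z' = Arc H x z' × Arc H z x'

StepCross : (H : Digraph) → Bool → V H → V H → V H → V H → Set
StepCross H b x z x' z' = if b then Crossing H x z x' z' else Crossing H x' z' x z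

avoid⇒uncrossed : ∀ {H t} (P Q : Walk H t) i {b} → dir P i ≡ b → dir Q i ≡ b →
  ¬ (FaithfulArc P Q i × FaithfulArc Q P i) →
  ¬ StepCross H b (vert P (inject₁ i)) (vert Q (inject₁ i)) (vert P (suc i)) (vert Q (suc i))
avoid⇒uncrossed P Q i eP eQ av with dir P i | dir Q i | eP | eQ
... | true  | true  | refl | refl = av
... | false | false | refl | refl = λ (c , c') → av (c' , c)
... | true  | false | refl | ()
... | false | true  | refl | ()

uncrossed⇒avoid : ∀ {H t} (P Q : Walk H t) i {b} → dir P i ≡ b → dir Q i ≡ b →
  ¬ StepCross H b (vert P (inject₁ i)) (vert Q (inject₁ i)) (vert P (suc i)) (vert Q (suc i)) →
  ¬ (FaithfulArc P Q i × FaithfulArc Q P i)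
uncrossed⇒avoid P Q i eP eQ nc with dir P i | dir Q i | eP | eQ
... | true  | true  | refl | refl = nc
... | false | false | refl | refl = λ (f , f') → nc (f' , f)
... | true  | false | refl | ()
... | false | true  | refl | ()

uncrossed-along : ∀ {H m} (A B : Walk H m) → Congruent A B → Avoid A B → ∀ {u v} →
  HatArc (dir A) u v → ¬ Crossing H (vert A u) (vert B u) (vert A v) (vert B v)
uncrossed-along A B AB av (j , inj₁ (refl , refl , e)) = avoid⇒uncrossed A B j e (trans (sym (AB j)) e) (av j)
uncrossed-along A B AB av (j , inj₂ (refl , refl , e)) = avoid⇒uncrossed A B j e (trans (sym (AB j)) e) (av j)

avoid-pullback : ∀ {H t m} {dS : Fin t → Bool} (A B : Walk H m) (AB : Congruent A B) → Avoid A B →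
  (P : PathMap dS (dir A)) → Avoid (pullback A P) (pullback B (congruent-map A B AB P))
avoid-pullback {H} {dS = dS} A B AB av P i =
  uncrossed⇒avoid (pullback A P) (pullback B (congruent-map A B AB P)) i refl refl (oriented (dS i) (steps P i))
  where
  oriented : ∀ b {u v} → OrientedArc (dir A) b u v →
    ¬ StepCross H b (vert A u) (vert B u) (vert A v) (vert B v)
  oriented true  = uncrossed-along A B AB av
  oriented false = uncrossed-along A B AB av

module Separation (H : Digraph) (a b : V H) where

  K : V H × V H → Set
  K = WeaklyConnectedStar H (a , b)

  K-forward : ∀ {s s'} → K s → StarArc H s s' → K s'
  K-forward k e = k ◅◅ (fwd e ◅ ε)

  K-backward : ∀ {s s'} → K s' → StarArc H s s' → K s
  K-backward k e = k ◅◅ (bwd e ◅ ε)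

  Separated : V H → V H → V H → Set
  Separated x y z = ¬ K (x , z) × ¬ K (z , y)

  separated-distinct : ∀ {x y z} → K (x , y) → Separated x y z → (x ≢ z) × (z ≢ y)
  separated-distinct k (nKxz , nKzy) = (λ { refl → nKzy k }) , (λ { refl → nKxz k })

  separation-forward : ∀ {p q r p' q' r'} → StarArc H (p , q) (p' , q') → K (p , q) → Arc H r r' →
    Separated p q r → ¬ Arc H r p' × ¬ Arc H r q' × Separated p' q' r'
  separation-forward {p} {q} {r} {p'} {q'} {r'} s@(_ , p'≢q' , pp , qq , pq-uncrossed) k rr sep =
    no-rp' , no-rq' , nKp'r' , nKr'q'
    where
    k' : K (p' , q')
    k' = K-forward k s
    nKpr = proj₁ sep
    nKrq = proj₂ sep
    p≢r = proj₁ (separated-distinct k sep)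
    r≢q = proj₂ (separated-distinct k sep)
    no-rq'-qp' : ¬ (Arc H r q' × Arc H q p')
    no-rq'-qp' (rq' , qp') = nKpr (K-backward k' (p≢r , p'≢q' , pp , rq' , λ (pq' , _) → pq-uncrossed (pq' , qp')))
    no-rp' : ¬ Arc H r p'
    no-rp' rp' = nKrq (K-backward k' (r≢q , p'≢q' , rp' , qq , no-rq'-qp'))
    no-rq' : ¬ Arc H r q'
    no-rq' rq' = nKpr (K-backward k' (p≢r , p'≢q' , pp , rq' , λ (_ , rp') → no-rp' rp'))
    nKp'r' : ¬ K (p' , r')
    nKp'r' k'' = nKpr (K-backward k'' (p≢r , (λ { refl → no-rp' rr }) , pp , rr , λ (_ , rp') → no-rp' rp'))
    nKr'q' : ¬ K (r' , q')
    nKr'q' k'' = nKrq (K-backward k'' (r≢q , (λ { refl → no-rq' rr }) , rr , qq , λ (rq' , _) → no-rq' rq'))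

  separation-backward : ∀ {p q r p' q' r'} → StarArc H (p , q) (p' , q') → K (p , q) → Arc H r r' →
    Separated p' q' r' → ¬ Arc H p r' × ¬ Arc H q r' × Separated p q r
  separation-backward {p} {q} {r} {p'} {q'} {r'} s@(p≢q , _ , pp , qq , pq-uncrossed) k rr sep =
    no-pr' , no-qr' , nKpr , nKrq
    where
    k' : K (p' , q')
    k' = K-forward k s
    nKp'r' = proj₁ sep
    nKr'q' = proj₂ sep
    p'≢r' = proj₁ (separated-distinct k' sep)
    r'≢q' = proj₂ (separated-distinct k' sep)
    no-pq'-qr' : ¬ (Arc H p q' × Arc H q r')
    no-pq'-qr' (pq' , qr') = nKp'r' (K-forward k (p≢q , p'≢r' , pp , qr' , λ (_ , qp') → pq-uncrossed (pq' , qp')))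
    no-pr' : ¬ Arc H p r'
    no-pr' pr' = nKr'q' (K-forward k (p≢q , r'≢q' , pr' , qq , no-pq'-qr'))
    no-qr' : ¬ Arc H q r'
    no-qr' qr' = nKp'r' (K-forward k (p≢q , p'≢r' , pp , qr' , λ (pr' , _) → no-pr' pr'))
    nKpr : ¬ K (p , r)
    nKpr k'' = nKp'r' (K-forward k'' ((λ { refl → no-pr' rr }) , p'≢r' , pp , rr , λ (pr' , _) → no-pr' pr'))
    nKrq : ¬ K (r , q)
    nKrq k'' = nKr'q' (K-forward k'' ((λ { refl → no-qr' rr }) , r'≢q' , rr , qq , λ (_ , qr') → no-qr' qr'))

  StarStep : Bool → V H × V H → V H × V H → Set
  StarStep b s s' = if b then StarArc H s s' else StarArc H s' s

  pair-step : ∀ b {x y x' y'} → ArcIn H b x x' → ArcIn H b y y' → ¬ StepCross H b x y x' y' →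
    x ≢ y → StarStep b (x , y) (x' , y')
  pair-step true  xx yy nc x≢y = x≢y , (λ { refl → nc (xx , yy) }) , xx , yy , nc
  pair-step false xx yy nc x≢y = (λ { refl → nc (yy , xx) }) , x≢y , xx , yy , nc

  step-distinct : ∀ b {x y x' y'} → StarStep b (x , y) (x' , y') → x' ≢ y'
  step-distinct true  e = proj₁ (proj₂ e)
  step-distinct false e = proj₁ e

  K-along : ∀ b {s s'} → StarStep b s s' → K s → K s'
  K-along true  e k = K-forward k e
  K-along false e k = K-backward k e

  triple-step : ∀ b {x y z x' y' z'} → StarStep b (x , y) (x' , y') → K (x , y) → ArcIn H b z z' →
    Separated x y z → ¬ StepCross H b x z x' z' × ¬ StepCross H b y z y' z' × Separated x' y' z'
  triple-step true e k zz sep =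
    let (no-zx' , no-zy' , sep') = separation-forward e k zz sep in
    (λ (_ , zx') → no-zx' zx') , (λ (_ , zy') → no-zy' zy') , sep'
  triple-step false e k zz sep =
    let (no-x'z , no-y'z , sep') = separation-backward e (K-backward k e) zz sep in
    (λ (x'z , _) → no-x'z x'z) , (λ (y'z , _) → no-y'z y'z) , sep'

avoid-third : ∀ {H t a b c} (X Y Z : Walk H t) → Congruent X Y → Congruent X Z → Avoid X Y →
  vert X zero ≡ a → vert Y zero ≡ b → vert Z zero ≡ c → a ≢ b →
  ¬ WeaklyConnectedStar H (a , b) (a , c) → ¬ WeaklyConnectedStar H (a , b) (c , b) →
  Avoid Y Z × Avoid X Z
avoid-third {H} X Y Z XY XZ avoidXY refl refl refl a≢b nKac nKcb =
  (λ i → uncrossed⇒avoid Y Z i (sym (XY i)) (sym (XZ i)) (proj₁ (proj₂ (triple i (separated (inject₁ i)))))) ,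
  (λ i → uncrossed⇒avoid X Z i refl (sym (XZ i)) (proj₁ (triple i (separated (inject₁ i)))))
  where
  open Separation H (vert X zero) (vert Y zero)
  x = vert X
  y = vert Y
  z = vert Z

  star : ∀ i → x (inject₁ i) ≢ y (inject₁ i) → StarStep (dir X i) (x (inject₁ i) , y (inject₁ i)) (x (suc i) , y (suc i))
  star i = pair-step (dir X i) (step-arc X i refl) (step-arc Y i (sym (XY i)))
                     (avoid⇒uncrossed X Y i refl (sym (XY i)) (avoidXY i))

  pairs : ∀ s → (x s ≢ y s) × K (x s , y s)
  pairs = <-weakInduction (λ s → (x s ≢ y s) × K (x s , y s)) (a≢b , ε)
    (λ i (x≢y , k) → step-distinct (dir X i) (star i x≢y) , K-along (dir X i) (star i x≢y) k)

  triple : ∀ i → Separated (x (inject₁ i)) (y (inject₁ i)) (z (inject₁ i)) →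
    ¬ StepCross H (dir X i) (x (inject₁ i)) (z (inject₁ i)) (x (suc i)) (z (suc i)) ×
    ¬ StepCross H (dir X i) (y (inject₁ i)) (z (inject₁ i)) (y (suc i)) (z (suc i)) ×
    Separated (x (suc i)) (y (suc i)) (z (suc i))
  triple i = triple-step (dir X i) (star i (proj₁ (pairs (inject₁ i)))) (proj₂ (pairs (inject₁ i)))
                         (step-arc Z i (sym (XZ i)))

  separated : ∀ s → Separated (x s) (y s) (z s)
  separated = <-weakInduction (λ s → Separated (x s) (y s) (z s)) (nKac , nKcb)
    (λ i sep → proj₂ (proj₂ (triple i sep)))

corollary6 : (H : Digraph) (a b c : V H) →
    a ≢ b → a ≢ c → b ≢ c →
    ¬ WeaklyConnectedStar H (a , b) (a , c) →
    ¬ WeaklyConnectedStar H (a , b) (c , b) →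
    (m k : ℕ) (A B : Walk H m) (C : Walk H k) →
    Constricted A → Constricted B → Constricted C →
    netLength A ≡ netLength B → netLength A ≡ netLength C →
    vert A zero ≡ a → vert B zero ≡ b → vert C zero ≡ c →
    Congruent A B → Avoid A B →
    Σ ℕ λ t → Σ (Fin t → Bool) λ dS →
    Σ (Fin (suc t) → Fin (suc m)) λ φA →
    Σ (Fin (suc t) → Fin (suc m)) λ φB →
    Σ (Fin (suc t) → Fin (suc k)) λ φC →
    Σ (Walk H t) λ A' → Σ (Walk H t) λ B' → Σ (Walk H t) λ C' →
      EndpointHom dS (dir A) φA × EndpointHom dS (dir B) φB × EndpointHom dS (dir C) φC ×
      PreImage dS A φA A' × PreImage dS B φB B' × PreImage dS C φC C' ×
      vert A' zero ≡ a × vert B' zero ≡ b × vert C' zero ≡ c ×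
      Avoid B' C' × Avoid A' C'
corollary6 H a b c a≢b _ _ nKac nKcb m k A B C cA _ cC _ eAC eA eB eC AB avoidAB =
  len , dirs , map PA , map PB , map PC , A' , B' , C' ,
  endpoint-hom PA , endpoint-hom PB , endpoint-hom PC ,
  pullback-pre-image A PA , pullback-pre-image B PB , pullback-pre-image C PC ,
  A'₀ , B'₀ , C'₀ ,
  avoid-third A' B' C' (λ _ → refl) (λ _ → refl) (avoid-pullback A B AB avoidAB PA)
              A'₀ B'₀ C'₀ a≢b nKac nKcb
  where
  -- B is congruent to A, so it is constricted too and reuses the map of A.
  open CommonPreImage (common-pre-image A C cA cC eAC) renaming (map₁ to PA; map₂ to PC)
  PB : PathMap dirs (dir B)
  PB = congruent-map A B AB PA
  A' B' C' : Walk H len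
  A' = pullback A PA
  B' = pullback B PB
  C' = pullback C PC
  A'₀ : vert A' zero ≡ a
  A'₀ = pullback-start A PA eA
  B'₀ : vert B' zero ≡ b
  B'₀ = pullback-start B PB eB
  C'₀ : vert C' zero ≡ c
  C'₀ = pullback-start C PC eC
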